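{- $\mathrm{Sort}(12)=\mathcal{C}(213)$.
   Context: A Cayley permutation is a finite word $\pi=\pi_1\cdots\pi_n$ over the positive integers such that every integer from $1$ to $\max(\pi)$ occurs at least once; $\mathcal{C}$ denotes the set of all Cayley permutations. A word $x=x_1\cdots x_n$ contains a pattern $p=p_1\cdots p_k$ if there are indices $i_1<\cdots<i_k$ such that for all $u,v$: $x_{i_u}<x_{i_v}$ iff $p_u<p_v$, and $x_{i_u}=x_{i_v}$ iff $p_u=p_v$; otherwise $x$ avoids $p$. $\mathcal{C}(213)$ is the set of Cayley permutations avoiding $213$. For a Cayley permutation $\tau$ of length at least two, a $\tau$-stack processes an input word from left to right with the following right-greedy algorithm: while the input is nonempty, if pushing the next input element onto the stack yields stack contents which, read from top to bottom, avoid $\tau$, the element is pushed; otherwise the top element of the stack is popped and appended to the output. When the input is exhausted, the remaining elements are popped one by one. Denote by $s_\tau(\pi)$ the output of the $\tau$-stack on input $\pi$. The $\sigma$-machine consists of a $\sigma$-stack followed in series by a $21$-stack: $s_\sigma(\pi)$ is used as input of a $21$-stack operated by the same algorithm with $\tau=21$. A Cayley permutation $\pi$ is $\sigma$-sortable if the final output of the $\sigma$-machine on input $\pi$ is weakly increasing; $\mathrm{Sort}(\sigma)$ denotes the set of $\sigma$-sortable Cayley permutations. Here $\sigma=12$. -}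

module Defs where

open import Data.Nat using (ℕ; zero; suc; _+_; _*_; _≤_; _⊔_; _<ᵇ_; _≡ᵇ_)
open import Data.Bool using (Bool; true; false; _∧_; if_then_else_; T)
open import Data.Bool.Properties using () renaming (_≟_ to _≟B_)
open import Data.List using (List; []; _∷_; _++_; length; foldr; zip; concatMap; map; [_])
open import Data.Bool.ListAction using (all; any)
open import Data.List.Relation.Unary.All using (All)
open import Data.List.Relation.Unary.Linked using (Linked)
open import Data.List.Membership.Propositional using (_∈_)
open import Data.Product using (_×_; _,_)

Word : Set
Word = List ℕ

maxW : Word → ℕ
maxW = foldr _⊔_ 0

IsCayley : Word → Set
IsCayley π = All (λ x → 1 ≤ x) π × (∀ k → 1 ≤ k → k ≤ maxW π → k ∈ π)

subseqs : Word → List Word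
subseqs [] = [] ∷ []
subseqs (x ∷ xs) = let r = subseqs xs in map (x ∷_) r ++ r

_==B_ : Bool → Bool → Bool
true ==B b = b
false ==B true = false
false ==B false = true

_==ℕ_ : ℕ → ℕ → Bool
zero ==ℕ zero = true
zero ==ℕ suc _ = false
suc _ ==ℕ zero = false
suc m ==ℕ suc n = m ==ℕ n

orderIso : Word → Word → Bool
orderIso y p =
  (length y ==ℕ length p) ∧
  all (λ { (a , b) → all (λ { (c , d) → ((a <ᵇ c) ==B (b <ᵇ d)) ∧ ((a ≡ᵇ c) ==B (b ≡ᵇ d)) }) zs }) zs
  where zs = zip y p

contains : Word → Word → Bool
contains x p = any (λ y → orderIso y p) (subseqs x)

Contains : Word → Word → Set
Contains x p = T (contains x p)

Avoids : Word → Word → Set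
Avoids x p = Contains x p → Data.Empty.⊥
  where import Data.Empty

-- The stack is a list whose head is
-- the top element, so "stack contents read from top to bottom" is the list
-- itself.  Fuel 2·|input|+1 suffices (each step pushes or pops).
stackRun : Word → ℕ → Word → Word → Word → Word
stackRun τ zero inp st out = out ++ st
stackRun τ (suc f) [] st out = out ++ st
stackRun τ (suc f) (x ∷ inp) [] out = stackRun τ f inp (x ∷ []) out
stackRun τ (suc f) (x ∷ inp) (t ∷ st) out =
  if contains (x ∷ t ∷ st) τ
    then stackRun τ f (x ∷ inp) st (out ++ [ t ])
    else stackRun τ f inp (x ∷ t ∷ st) out

sτ : Word → Word → Word
sτ τ π = stackRun τ (suc (2 * length π)) π [] []

machine : Word → Word → Word
machine σ π = sτ (2 ∷ 1 ∷ []) (sτ σ π)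

WeaklyIncreasing : Word → Set
WeaklyIncreasing = Linked _≤_

Sortable : Word → Word → Set
Sortable σ π = WeaklyIncreasing (machine σ π)

-- The 12-stack keeps its contents weakly increasing from bottom to top and pops exactly when
-- the incoming letter is smaller than its top; the 21-stack is the mirror image.  If b a c is an
-- occurrence of 213 in the input, b is popped at the latest when a arrives, and afterwards c is
-- output before some letter smaller than b still waiting on the stack or in the input: the output
-- contains 231.  Conversely a 231 in the output can only arise from a 213 in the input.  Finally,
-- as in Knuth's analysis of stack sorting, the 21-stack sorts exactly the 231-avoiding words.

module Submission where

open import Defs
open import Data.Bool using (Bool; true; false; T; if_then_else_)
open import Data.Bool.Properties using (T-≡)
open import Data.Empty using (⊥-elim)
open import Data.List using (List; []; _∷_; _++_; length; map)
open import Data.List.Properties using (++-assoc)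
open import Data.List.Membership.Propositional using (_∈_; lose)
open import Data.List.Relation.Binary.Sublist.Propositional using (_⊆_; []; _∷_; _∷ʳ_; to∈; from∈; minimum)
open import Data.List.Relation.Unary.All as All using (All; _∷_)
open import Data.List.Relation.Unary.Linked as Linked using (Linked; []; [-]; _∷_)
open import Data.List.Relation.Unary.Linked.Properties using (Linked⇒All)
open import Data.List.Relation.Binary.Sublist.Propositional.Properties using (∷ˡ⁻)
open import Data.List.Relation.Unary.Any using (Any; here; there)
import Data.List.Relation.Unary.Any.Properties as Any
open import Data.Nat using (ℕ; zero; suc; _+_; _*_; s≤s; s≤s⁻¹; _<_; _≤_; _≥_; _<ᵇ_; _≡ᵇ_)
open import Data.Nat.Properties
open import Data.Product using (∃-syntax; _×_; _,_)
open import Data.Sum using (_⊎_; inj₁; inj₂; [_,_]′)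
open import Data.Unit using (tt)
open import Function using (_∘_; flip; _⇔_; mk⇔; Equivalence)
open import Relation.Binary.Definitions using (Transitive; tri<; tri≈; tri>)
open import Relation.Binary.PropositionalEquality
open import Relation.Nullary using (¬_; yes; no)
open import Relation.Unary using (Pred)
open import Function.Properties.Equivalence using (⇔-setoid)
open import Function.Related.TypeIsomorphisms using (¬-cong-⇔)
open import Level using (0ℓ)
import Relation.Binary.Reasoning.Setoid as SetoidReasoning

private
  variable
    Shape : Word → Set

<⇒<ᵇ≡true : ∀ {a b} → a < b → (a <ᵇ b) ≡ true
<⇒<ᵇ≡true a<b = Equivalence.to T-≡ (<⇒<ᵇ a<b)

≥⇒<ᵇ≡false : ∀ {a b} → b ≤ a → (a <ᵇ b) ≡ false
≥⇒<ᵇ≡false {a} {b} b≤a with a <ᵇ b in eq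
... | false = refl
... | true = ⊥-elim (≤⇒≯ b≤a (<ᵇ⇒< a b (subst T (sym eq) tt)))

≡ᵇ-refl : ∀ a → (a ≡ᵇ a) ≡ true
≡ᵇ-refl a = Equivalence.to T-≡ (≡⇒≡ᵇ a a refl)

≢⇒≡ᵇ≡false : ∀ {a b} → a ≢ b → (a ≡ᵇ b) ≡ false
≢⇒≡ᵇ≡false {a} {b} a≢b with a ≡ᵇ b in eq
... | false = refl
... | true = ⊥-elim (a≢b (≡ᵇ⇒≡ a b (subst T (sym eq) tt)))

subseqs-Any⁺ : ∀ {ℓ} {P : Pred Word ℓ} {y w} → y ⊆ w → P y → Any P (subseqs w)
subseqs-Any⁺ [] py = here py
subseqs-Any⁺ (_∷ʳ_ {ys = w} x s) py = Any.++⁺ʳ (map (x ∷_) (subseqs w)) (subseqs-Any⁺ s py)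
subseqs-Any⁺ (refl ∷ s) py = Any.++⁺ˡ (Any.map⁺ (subseqs-Any⁺ s py))

subseqs-Any⁻ : ∀ {ℓ} {P : Pred Word ℓ} w → Any P (subseqs w) → ∃[ y ] y ⊆ w × P y
subseqs-Any⁻ [] (here py) = [] , [] , py
subseqs-Any⁻ (x ∷ w) p with Any.++⁻ (map (x ∷_) (subseqs w)) p
... | inj₁ q with subseqs-Any⁻ w (Any.map⁻ q)
...   | y , s , py = x ∷ y , refl ∷ s , py
subseqs-Any⁻ (x ∷ w) p | inj₂ q with subseqs-Any⁻ w q
...   | y , s , py = y , x ∷ʳ s , py

-- A pattern is represented by the predicate Shape of the words order-isomorphic to it.
Occurs : (Word → Set) → Word → Set
Occurs Shape w = ∃[ y ] y ⊆ w × Shape y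

contains⇔Occurs : ∀ {p} → (∀ {y} → T (orderIso y p) ⇔ Shape y) →
                  ∀ w → Contains w p ⇔ Occurs Shape w
contains⇔Occurs shape w = mk⇔
  (λ c → let y , s , iso = subseqs-Any⁻ w (Any.any⁻ _ (subseqs w) c) in y , s , Equivalence.to shape iso)
  (λ { (y , s , sh) → Any.any⁺ _ (subseqs-Any⁺ s (Equivalence.from shape sh)) })

Occurs-∷ʳ : ∀ {t w} → Occurs Shape w → Occurs Shape (t ∷ w)
Occurs-∷ʳ (y , s , sh) = y , _ ∷ʳ s , sh

Occurs-∷⁺ : ∀ {t w} → Occurs (Shape ∘ (t ∷_)) w → Occurs Shape (t ∷ w)
Occurs-∷⁺ {t = t} (y , s , sh) = t ∷ y , refl ∷ s , sh

Occurs-∷⁻ : ∀ {t w} → Occurs Shape (t ∷ w) → Occurs Shape w ⊎ Occurs (Shape ∘ (t ∷_)) w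
Occurs-∷⁻ (y , _ ∷ʳ s , sh) = inj₁ (y , s , sh)
Occurs-∷⁻ (_ ∷ y , refl ∷ s , sh) = inj₂ (y , s , sh)

data Is12 : Word → Set where
  is12 : ∀ {a b} → a < b → Is12 (a ∷ b ∷ [])

data Is21 : Word → Set where
  is21 : ∀ {a b} → a < b → Is21 (b ∷ a ∷ [])

data Is213 : Word → Set where
  is213 : ∀ {a b c} → a < b → b < c → Is213 (b ∷ a ∷ c ∷ [])

data Is231 : Word → Set where
  is231 : ∀ {a b c} → a < b → b < c → Is231 (b ∷ c ∷ a ∷ [])

-- On words of the wrong length orderIso computes to false, hence the single clauses of to.
orderIso-12 : ∀ {y} → T (orderIso y (1 ∷ 2 ∷ [])) ⇔ Is12 y
orderIso-12 = mk⇔ to from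
  where
  to : ∀ {y} → T (orderIso y (1 ∷ 2 ∷ [])) → Is12 y
  to {a ∷ b ∷ []} iso with <-cmp a b
  ... | tri< a<b _ _ = is12 a<b
  ... | tri≈ _ refl _ rewrite ≥⇒<ᵇ≡false (≤-refl {a}) | ≡ᵇ-refl a = ⊥-elim iso
  ... | tri> _ _ b<a rewrite ≥⇒<ᵇ≡false (≤-refl {a}) | ≡ᵇ-refl a | ≥⇒<ᵇ≡false (<⇒≤ b<a) = ⊥-elim iso
  from : ∀ {y} → Is12 y → T (orderIso y (1 ∷ 2 ∷ []))
  from (is12 {a} {b} a<b)
    rewrite ≥⇒<ᵇ≡false (≤-refl {a}) | ≡ᵇ-refl a | <⇒<ᵇ≡true a<b | ≢⇒≡ᵇ≡false (<⇒≢ a<b)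
          | ≥⇒<ᵇ≡false (<⇒≤ a<b) | ≢⇒≡ᵇ≡false (>⇒≢ a<b) | ≥⇒<ᵇ≡false (≤-refl {b}) | ≡ᵇ-refl b = tt

orderIso-21 : ∀ {y} → T (orderIso y (2 ∷ 1 ∷ [])) ⇔ Is21 y
orderIso-21 = mk⇔ to from
  where
  to : ∀ {y} → T (orderIso y (2 ∷ 1 ∷ [])) → Is21 y
  to {b ∷ a ∷ []} iso with <-cmp a b
  ... | tri< a<b _ _ = is21 a<b
  ... | tri≈ _ refl _ rewrite ≥⇒<ᵇ≡false (≤-refl {a}) | ≡ᵇ-refl a = ⊥-elim iso
  ... | tri> _ _ b<a rewrite ≥⇒<ᵇ≡false (≤-refl {b}) | ≡ᵇ-refl b | <⇒<ᵇ≡true b<a = ⊥-elim iso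
  from : ∀ {y} → Is21 y → T (orderIso y (2 ∷ 1 ∷ []))
  from (is21 {a} {b} a<b)
    rewrite ≥⇒<ᵇ≡false (≤-refl {b}) | ≡ᵇ-refl b | ≥⇒<ᵇ≡false (<⇒≤ a<b) | ≢⇒≡ᵇ≡false (>⇒≢ a<b)
          | <⇒<ᵇ≡true a<b | ≢⇒≡ᵇ≡false (<⇒≢ a<b) | ≥⇒<ᵇ≡false (≤-refl {a}) | ≡ᵇ-refl a = tt

orderIso-213 : ∀ {y} → T (orderIso y (2 ∷ 1 ∷ 3 ∷ [])) ⇔ Is213 y
orderIso-213 = mk⇔ to from
  where
  to : ∀ {y} → T (orderIso y (2 ∷ 1 ∷ 3 ∷ [])) → Is213 y
  to {b ∷ a ∷ c ∷ []} iso with <-cmp a b | b <? c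
  ... | tri< a<b _ _ | yes b<c = is213 a<b b<c
  ... | tri< a<b _ _ | no b≮c
    rewrite ≥⇒<ᵇ≡false (≤-refl {b}) | ≡ᵇ-refl b | ≥⇒<ᵇ≡false (<⇒≤ a<b) | ≢⇒≡ᵇ≡false (>⇒≢ a<b)
          | ≥⇒<ᵇ≡false (≮⇒≥ b≮c) = ⊥-elim iso
  ... | tri≈ _ refl _ | _ rewrite ≥⇒<ᵇ≡false (≤-refl {a}) | ≡ᵇ-refl a = ⊥-elim iso
  ... | tri> _ _ b<a | _ rewrite ≥⇒<ᵇ≡false (≤-refl {b}) | ≡ᵇ-refl b | <⇒<ᵇ≡true b<a = ⊥-elim iso
  from : ∀ {y} → Is213 y → T (orderIso y (2 ∷ 1 ∷ 3 ∷ []))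
  from (is213 {a} {b} {c} a<b b<c)
    rewrite ≥⇒<ᵇ≡false (≤-refl {a}) | ≡ᵇ-refl a | ≥⇒<ᵇ≡false (≤-refl {b}) | ≡ᵇ-refl b
          | ≥⇒<ᵇ≡false (≤-refl {c}) | ≡ᵇ-refl c
          | <⇒<ᵇ≡true a<b | ≢⇒≡ᵇ≡false (<⇒≢ a<b) | ≥⇒<ᵇ≡false (<⇒≤ a<b) | ≢⇒≡ᵇ≡false (>⇒≢ a<b)
          | <⇒<ᵇ≡true b<c | ≢⇒≡ᵇ≡false (<⇒≢ b<c) | ≥⇒<ᵇ≡false (<⇒≤ b<c) | ≢⇒≡ᵇ≡false (>⇒≢ b<c)
          | <⇒<ᵇ≡true (<-trans a<b b<c) | ≢⇒≡ᵇ≡false (<⇒≢ (<-trans a<b b<c))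
          | ≥⇒<ᵇ≡false (<⇒≤ (<-trans a<b b<c)) | ≢⇒≡ᵇ≡false (>⇒≢ (<-trans a<b b<c)) = tt

contains-12⇔ : ∀ w → Contains w (1 ∷ 2 ∷ []) ⇔ Occurs Is12 w
contains-12⇔ = contains⇔Occurs orderIso-12

contains-21⇔ : ∀ w → Contains w (2 ∷ 1 ∷ []) ⇔ Occurs Is21 w
contains-21⇔ = contains⇔Occurs orderIso-21

contains-213⇔ : ∀ w → Contains w (2 ∷ 1 ∷ 3 ∷ []) ⇔ Occurs Is213 w
contains-213⇔ = contains⇔Occurs orderIso-213

≥-trans : Transitive _≥_
≥-trans = flip ≤-trans

Linked-∷ : ∀ {R : ℕ → ℕ → Set} {t l} → All (R t) l → Linked R l → Linked R (t ∷ l)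
Linked-∷ All.[] _ = [-]
Linked-∷ (r ∷ _) lk = r ∷ lk

Linked⇒All-head : ∀ {R : ℕ → ℕ → Set} → Transitive R → ∀ {a w} → Linked R (a ∷ w) → All (R a) w
Linked⇒All-head trans [-] = All.[]
Linked⇒All-head trans (r ∷ lk) = Linked⇒All trans r lk

Linked-⊆ : ∀ {R : ℕ → ℕ → Set} → Transitive R → ∀ {a b l w} → Linked R w → a ∷ b ∷ l ⊆ w → R a b
Linked-⊆ trans lk (_ ∷ʳ s) = Linked-⊆ trans (Linked.tail lk) s
Linked-⊆ trans lk (refl ∷ s) = All.lookup (Linked⇒All-head trans lk) (to∈ s)

sorted-avoids21 : ∀ {w} → Linked _≤_ w → ¬ Occurs Is21 w
sorted-avoids21 lk (_ , s , is21 a<b) = <⇒≱ a<b (Linked-⊆ ≤-trans lk s)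

decreasing-avoids231 : ∀ {w} → Linked _≥_ w → ¬ Occurs Is231 w
decreasing-avoids231 lk (_ , s , is231 _ b<c) = <⇒≱ b<c (Linked-⊆ ≥-trans lk s)

run : Word → ℕ → Word → Word → Word
run τ f inp st = stackRun τ f inp st []

stackRun-++ : ∀ τ f inp st out → stackRun τ f inp st out ≡ out ++ run τ f inp st
stackRun-++ τ zero inp st out = refl
stackRun-++ τ (suc f) [] st out = refl
stackRun-++ τ (suc f) (x ∷ inp) [] out = stackRun-++ τ f inp (x ∷ []) out
stackRun-++ τ (suc f) (x ∷ inp) (t ∷ st) out with contains (x ∷ t ∷ st) τ
... | false = stackRun-++ τ f inp (x ∷ t ∷ st) out
... | true = begin
  stackRun τ f (x ∷ inp) st (out ++ t ∷ [])  ≡⟨ stackRun-++ τ f (x ∷ inp) st (out ++ t ∷ []) ⟩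
  (out ++ t ∷ []) ++ run τ f (x ∷ inp) st    ≡⟨ ++-assoc out (t ∷ []) _ ⟩
  out ++ t ∷ run τ f (x ∷ inp) st            ≡⟨ cong (out ++_) (stackRun-++ τ f (x ∷ inp) st (t ∷ [])) ⟨
  out ++ stackRun τ f (x ∷ inp) st (t ∷ [])  ∎
  where open ≡-Reasoning

data Step (τ : Word) (f x : ℕ) (inp : Word) (t : ℕ) (st : Word) : Set where
  pop  : Contains (x ∷ t ∷ st) τ →
         run τ (suc f) (x ∷ inp) (t ∷ st) ≡ t ∷ run τ f (x ∷ inp) st → Step τ f x inp t st
  push : ¬ Contains (x ∷ t ∷ st) τ →
         run τ (suc f) (x ∷ inp) (t ∷ st) ≡ run τ f inp (x ∷ t ∷ st) → Step τ f x inp t st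

step : ∀ τ f x inp t st → Step τ f x inp t st
step τ f x inp t st = decide (contains (x ∷ t ∷ st) τ) refl
  where
  next : Bool → Word
  next b = if b then stackRun τ f (x ∷ inp) st (t ∷ []) else run τ f inp (x ∷ t ∷ st)
  decide : ∀ b → contains (x ∷ t ∷ st) τ ≡ b → Step τ f x inp t st
  decide true eq = pop (subst T (sym eq) tt) (trans (cong next eq) (stackRun-++ τ f (x ∷ inp) st (t ∷ [])))
  decide false eq = push (subst T eq) (cong next eq)

⊆-run : ∀ τ f inp st {l} → l ⊆ st → l ⊆ run τ f inp st
⊆-run τ zero inp st s = s
⊆-run τ (suc f) [] st s = s
⊆-run τ (suc f) (x ∷ inp) [] s = ⊆-run τ f inp (x ∷ []) (x ∷ʳ s)
⊆-run τ (suc f) (x ∷ inp) (t ∷ st) s with step τ f x inp t st | s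
... | pop _ e | t ∷ʳ s′ rewrite e = t ∷ʳ ⊆-run τ f (x ∷ inp) st s′
... | pop _ e | refl ∷ s′ rewrite e = refl ∷ ⊆-run τ f (x ∷ inp) st s′
... | push _ e | _ rewrite e = ⊆-run τ f inp (x ∷ t ∷ st) (x ∷ʳ s)

∈-run⁻ : ∀ τ f inp st {z} → z ∈ run τ f inp st → z ∈ st ⊎ z ∈ inp
∈-run⁻ τ zero inp st z∈ = inj₁ z∈
∈-run⁻ τ (suc f) [] st z∈ = inj₁ z∈
∈-run⁻ τ (suc f) (x ∷ inp) [] z∈ with ∈-run⁻ τ f inp (x ∷ []) z∈
... | inj₁ (here refl) = inj₂ (here refl)
... | inj₂ z∈inp = inj₂ (there z∈inp)
∈-run⁻ τ (suc f) (x ∷ inp) (t ∷ st) z∈ with step τ f x inp t st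
... | pop _ e rewrite e with z∈
...   | here refl = inj₁ (here refl)
...   | there z∈′ with ∈-run⁻ τ f (x ∷ inp) st z∈′
...     | inj₁ z∈st = inj₁ (there z∈st)
...     | inj₂ z∈inp = inj₂ z∈inp
∈-run⁻ τ (suc f) (x ∷ inp) (t ∷ st) z∈ | push _ e rewrite e with ∈-run⁻ τ f inp (x ∷ t ∷ st) z∈
...   | inj₁ (here refl) = inj₂ (here refl)
...   | inj₁ (there z∈st) = inj₁ z∈st
...   | inj₂ z∈inp = inj₂ (there z∈inp)

-- Each step pushes or pops, so with this much fuel a run reads its whole input.
record Fuel (f : ℕ) (inp st : Word) : Set where
  constructor fuel
  field bound : length inp + length inp + length st < f

fuel-push : ∀ {f x inp st} → Fuel (suc f) (x ∷ inp) st → Fuel f inp (x ∷ st)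
fuel-push {f} {x} {inp} {st} (fuel h) = fuel (≤-trans (≤-reflexive eq) (s≤s⁻¹ h))
  where
  n = length inp
  eq : suc (n + n + suc (length st)) ≡ suc n + suc n + length st
  eq = begin
    suc (n + n + suc (length st))   ≡⟨ cong suc (+-suc (n + n) (length st)) ⟩
    suc (suc (n + n) + length st)   ≡⟨ cong (λ m → suc (m + length st)) (+-suc n n) ⟨
    suc n + suc n + length st       ∎
    where open ≡-Reasoning

fuel-pop : ∀ {f inp t st} → Fuel (suc f) inp (t ∷ st) → Fuel f inp st
fuel-pop {st = st} (fuel h) = fuel (≤-trans (≤-reflexive (sym (+-suc _ (length st)))) (s≤s⁻¹ h))

fuel-init : ∀ w → Fuel (suc (2 * length w)) w []
fuel-init w = fuel (s≤s (≤-reflexive (+-assoc (length w) (length w) 0)))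

∈-run⁺ : ∀ τ f inp st {z} → Fuel f inp st → z ∈ inp → z ∈ run τ f inp st
∈-run⁺ τ (suc f) (x ∷ inp) [] _ (here refl) = to∈ (⊆-run τ f inp (x ∷ []) (refl ∷ []))
∈-run⁺ τ (suc f) (x ∷ inp) [] enough (there z∈) = ∈-run⁺ τ f inp (x ∷ []) (fuel-push enough) z∈
∈-run⁺ τ (suc f) (x ∷ inp) (t ∷ st) enough z∈ with step τ f x inp t st
... | pop _ e rewrite e = there (∈-run⁺ τ f (x ∷ inp) st (fuel-pop enough) z∈)
... | push _ e rewrite e with z∈
...   | here refl = to∈ (⊆-run τ f inp (x ∷ t ∷ st) (refl ∷ minimum _))
...   | there z∈′ = ∈-run⁺ τ f inp (x ∷ t ∷ st) (fuel-push enough) z∈′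

decreasing-contains-12⇔ : ∀ {x t st} → Linked _≥_ (t ∷ st) → Contains (x ∷ t ∷ st) (1 ∷ 2 ∷ []) ⇔ x < t
decreasing-contains-12⇔ {x} {t} {st} lk = mk⇔ (to ∘ Equivalence.to (contains-12⇔ _)) from
  where
  to : Occurs Is12 (x ∷ t ∷ st) → x < t
  to (_ , _ ∷ʳ s , is12 a<b) = ⊥-elim (<⇒≱ a<b (Linked-⊆ ≥-trans lk s))
  to (_ , refl ∷ (refl ∷ _) , is12 x<t) = x<t
  to (_ , refl ∷ (_ ∷ʳ s) , is12 x<b) = <-≤-trans x<b (All.lookup (Linked⇒All-head ≥-trans lk) (to∈ s))
  from : x < t → Contains (x ∷ t ∷ st) (1 ∷ 2 ∷ [])
  from x<t = Equivalence.from (contains-12⇔ _) (_ , refl ∷ refl ∷ minimum st , is12 x<t)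

increasing-contains-21⇔ : ∀ {x t st} → Linked _≤_ (t ∷ st) → Contains (x ∷ t ∷ st) (2 ∷ 1 ∷ []) ⇔ t < x
increasing-contains-21⇔ {x} {t} {st} lk = mk⇔ (to ∘ Equivalence.to (contains-21⇔ _)) from
  where
  to : Occurs Is21 (x ∷ t ∷ st) → t < x
  to (_ , _ ∷ʳ s , is21 a<b) = ⊥-elim (<⇒≱ a<b (Linked-⊆ ≤-trans lk s))
  to (_ , refl ∷ (refl ∷ _) , is21 t<x) = t<x
  to (_ , refl ∷ (_ ∷ʳ s) , is21 a<x) = ≤-<-trans (All.lookup (Linked⇒All-head ≤-trans lk) (to∈ s)) a<x
  from : t < x → Contains (x ∷ t ∷ st) (2 ∷ 1 ∷ [])
  from t<x = Equivalence.from (contains-21⇔ _) (_ , refl ∷ refl ∷ minimum st , is21 t<x)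

-- The occurrences a run with stack st and remaining input inp still has to face: Pending ones
-- have their first letter waiting on the stack, the others lie entirely in the input.
Pending : (Word → Set) → Word → Word → Set
Pending Shape st inp = ∃[ b ] ∃[ rest ] b ∈ st × rest ⊆ inp × Shape (b ∷ rest)

Upcoming : (Word → Set) → Word → Word → Set
Upcoming Shape st inp = Occurs Shape inp ⊎ Pending Shape st inp

upcoming-[]⁻ : ∀ {inp} → Upcoming Shape [] inp → Occurs Shape inp
upcoming-[]⁻ (inj₁ o) = o
upcoming-[]⁻ (inj₂ (_ , _ , () , _))

upcoming-pop : ∀ {t st inp} → Upcoming Shape st inp → Upcoming Shape (t ∷ st) inp
upcoming-pop (inj₁ o) = inj₁ o
upcoming-pop (inj₂ (b , rest , b∈ , s , sh)) = inj₂ (b , rest , there b∈ , s , sh)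

upcoming-pop⁻ : ∀ {t st inp} → Upcoming Shape (t ∷ st) inp →
                Upcoming Shape st inp ⊎ Occurs (Shape ∘ (t ∷_)) inp
upcoming-pop⁻ (inj₁ o) = inj₁ (inj₁ o)
upcoming-pop⁻ (inj₂ (_ , rest , here refl , s , sh)) = inj₂ (rest , s , sh)
upcoming-pop⁻ (inj₂ (b , rest , there b∈ , s , sh)) = inj₁ (inj₂ (b , rest , b∈ , s , sh))

upcoming-push⁻ : ∀ {x st inp} → Upcoming Shape (x ∷ st) inp → Upcoming Shape st (x ∷ inp)
upcoming-push⁻ (inj₁ o) = inj₁ (Occurs-∷ʳ o)
upcoming-push⁻ (inj₂ (b , rest , here refl , s , sh)) = inj₁ (b ∷ rest , refl ∷ s , sh)
upcoming-push⁻ (inj₂ (b , rest , there b∈ , s , sh)) = inj₂ (b , rest , b∈ , _ ∷ʳ s , sh)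

upcoming-push⁺ : ∀ {x st inp} → (∀ {b rest} → b ∈ st → ¬ Shape (b ∷ x ∷ rest)) →
                 Upcoming Shape st (x ∷ inp) → Upcoming Shape (x ∷ st) inp
upcoming-push⁺ _ (inj₁ (y , _ ∷ʳ s , sh)) = inj₁ (y , s , sh)
upcoming-push⁺ _ (inj₁ (_ ∷ rest , refl ∷ s , sh)) = inj₂ (_ , rest , here refl , s , sh)
upcoming-push⁺ _ (inj₂ (b , rest , b∈ , _ ∷ʳ s , sh)) = inj₂ (b , rest , there b∈ , s , sh)
upcoming-push⁺ ok (inj₂ (b , _ ∷ _ , b∈ , refl ∷ s , sh)) = ⊥-elim (ok b∈ sh)

run12-avoids231 : ∀ f inp st → Linked _≥_ st → ¬ Upcoming Is213 st inp →
                  ¬ Occurs Is231 (run (1 ∷ 2 ∷ []) f inp st)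
run12-avoids231 zero inp st lk _ = decreasing-avoids231 lk
run12-avoids231 (suc f) [] st lk _ = decreasing-avoids231 lk
run12-avoids231 (suc f) (x ∷ inp) [] lk ¬up = run12-avoids231 f inp (x ∷ []) [-] (¬up ∘ upcoming-push⁻)
run12-avoids231 (suc f) (x ∷ inp) (t ∷ st) lk ¬up with step (1 ∷ 2 ∷ []) f x inp t st
... | push ¬pops e rewrite e = run12-avoids231 f inp (x ∷ t ∷ st) (t≤x ∷ lk) (¬up ∘ upcoming-push⁻)
  where
  t≤x : t ≤ x
  t≤x = ≮⇒≥ (¬pops ∘ Equivalence.from (decreasing-contains-12⇔ lk))
... | pop pops e rewrite e = [ rest , completed ]′ ∘ Occurs-∷⁻
  where
  x<t : x < t
  x<t = Equivalence.to (decreasing-contains-12⇔ lk) pops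
  rest : ¬ Occurs Is231 (run (1 ∷ 2 ∷ []) f (x ∷ inp) st)
  rest = run12-avoids231 f (x ∷ inp) st (Linked.tail lk) (¬up ∘ upcoming-pop)
  completed : ¬ Occurs (Is231 ∘ (t ∷_)) (run (1 ∷ 2 ∷ []) f (x ∷ inp) st)
  completed (_ , s , is231 _ t<c) with ∈-run⁻ _ f (x ∷ inp) st (to∈ s)
  ... | inj₁ c∈st = <⇒≱ t<c (All.lookup (Linked⇒All-head ≥-trans lk) c∈st)
  ... | inj₂ (here refl) = <-asym x<t t<c
  ... | inj₂ (there c∈inp) = ¬up (inj₂ (t , _ , here refl , refl ∷ from∈ c∈inp , is213 x<t t<c))

data Below (t : ℕ) : Word → Word → Set where
  stacked : ∀ {a st inp} → a < t → a ∈ st → Below t st inp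
  next    : ∀ {x st inp} → x < t → Below t st (x ∷ inp)

below-push : ∀ {t x st inp} → Below t st (x ∷ inp) → Below t (x ∷ st) inp
below-push (stacked a<t a∈) = stacked a<t (there a∈)
below-push (next x<t) = stacked x<t (here refl)

below-pop : ∀ {t u x st inp} → x < u → Below t (u ∷ st) (x ∷ inp) → Below t st (x ∷ inp)
below-pop x<u (stacked u<t (here refl)) = next (<-trans x<u u<t)
below-pop x<u (stacked a<t (there a∈)) = stacked a<t a∈
below-pop x<u (next x<t) = next x<t

-- Once t has been popped by a smaller letter, some letter smaller than t is always on the stack
-- or next in the input; a letter c > t still to come is pushed on top of such a letter, so c is
-- output before it.
run12-completes231 : ∀ t f inp st → Fuel f inp st → Linked _≥_ st → Below t st inp → Any (t <_) inp →
                   Occurs (Is231 ∘ (t ∷_)) (run (1 ∷ 2 ∷ []) f inp st)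
run12-completes231 t (suc f) (x ∷ inp) [] enough _ (next x<t) (here t<x) = ⊥-elim (<-asym x<t t<x)
run12-completes231 t (suc f) (x ∷ inp) [] enough _ below (there above) =
  run12-completes231 t f inp (x ∷ []) (fuel-push enough) [-] (below-push below) above
run12-completes231 t (suc f) (x ∷ inp) (u ∷ st) enough lk below above with step (1 ∷ 2 ∷ []) f x inp u st
... | pop pops e rewrite e =
  Occurs-∷ʳ (run12-completes231 t f (x ∷ inp) st (fuel-pop enough) (Linked.tail lk) (below-pop x<u below) above)
  where
  x<u : x < u
  x<u = Equivalence.to (decreasing-contains-12⇔ lk) pops
... | push ¬pops e rewrite e with below | above
...   | next x<t | here t<x = ⊥-elim (<-asym x<t t<x)
...   | stacked a<t a∈ | here t<x = _ , ⊆-run _ f inp (x ∷ u ∷ st) (refl ∷ from∈ a∈) , is231 a<t t<x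
...   | _ | there above′ =
  run12-completes231 t f inp (x ∷ u ∷ st) (fuel-push enough) (u≤x ∷ lk) (below-push below) above′
  where
  u≤x : u ≤ x
  u≤x = ≮⇒≥ (¬pops ∘ Equivalence.from (decreasing-contains-12⇔ lk))

run12-creates231 : ∀ f inp st → Fuel f inp st → Linked _≥_ st → Upcoming Is213 st inp →
                 Occurs Is231 (run (1 ∷ 2 ∷ []) f inp st)
run12-creates231 (suc f) [] st _ _ (inj₁ (_ , [] , ()))
run12-creates231 (suc f) [] st _ _ (inj₂ (_ , _ , _ , [] , ()))
run12-creates231 (suc f) (x ∷ inp) [] enough _ up =
  run12-creates231 f inp (x ∷ []) (fuel-push enough) [-] (upcoming-push⁺ (λ ()) up)
run12-creates231 (suc f) (x ∷ inp) (t ∷ st) enough lk up with step (1 ∷ 2 ∷ []) f x inp t st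
... | push ¬pops e rewrite e =
  run12-creates231 f inp (x ∷ t ∷ st) (fuel-push enough) (t≤x ∷ lk) (upcoming-push⁺ unblocked up)
  where
  t≤x : t ≤ x
  t≤x = ≮⇒≥ (¬pops ∘ Equivalence.from (decreasing-contains-12⇔ lk))
  unblocked : ∀ {b rest} → b ∈ t ∷ st → ¬ Is213 (b ∷ x ∷ rest)
  unblocked b∈ (is213 x<b _) = <⇒≱ x<b (All.lookup (Linked⇒All ≥-trans t≤x lk) b∈)
... | pop pops e rewrite e with upcoming-pop⁻ up
...   | inj₁ up′ = Occurs-∷ʳ (run12-creates231 f (x ∷ inp) st (fuel-pop enough) (Linked.tail lk) up′)
...   | inj₂ (_ , s , is213 _ t<c) =
  Occurs-∷⁺ (run12-completes231 t f (x ∷ inp) st (fuel-pop enough) (Linked.tail lk)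
              (next (Equivalence.to (decreasing-contains-12⇔ lk) pops)) (lose (to∈ (∷ˡ⁻ s)) t<c))

s12-avoids231⇔avoids213 : ∀ π → (¬ Occurs Is231 (sτ (1 ∷ 2 ∷ []) π)) ⇔ (¬ Occurs Is213 π)
s12-avoids231⇔avoids213 π = mk⇔
  (λ ¬o231 o213 → ¬o231 (run12-creates231 (suc (2 * length π)) π [] (fuel-init π) [] (inj₁ o213)))
  (λ ¬o → run12-avoids231 (suc (2 * length π)) π [] [] (¬o ∘ upcoming-[]⁻))

run21-sorted : ∀ f inp st → Linked _≤_ st → ¬ Upcoming Is231 st inp →
               Linked _≤_ (run (2 ∷ 1 ∷ []) f inp st)
run21-sorted zero inp st lk _ = lk
run21-sorted (suc f) [] st lk _ = lk
run21-sorted (suc f) (x ∷ inp) [] lk ¬up = run21-sorted f inp (x ∷ []) [-] (¬up ∘ upcoming-push⁻)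
run21-sorted (suc f) (x ∷ inp) (t ∷ st) lk ¬up with step (2 ∷ 1 ∷ []) f x inp t st
... | push ¬pops e rewrite e = run21-sorted f inp (x ∷ t ∷ st) (x≤t ∷ lk) (¬up ∘ upcoming-push⁻)
  where
  x≤t : x ≤ t
  x≤t = ≮⇒≥ (¬pops ∘ Equivalence.from (increasing-contains-21⇔ lk))
... | pop pops e rewrite e =
  Linked-∷ (All.tabulate lower-bound) (run21-sorted f (x ∷ inp) st (Linked.tail lk) (¬up ∘ upcoming-pop))
  where
  t<x : t < x
  t<x = Equivalence.to (increasing-contains-21⇔ lk) pops
  lower-bound : ∀ {z} → z ∈ run (2 ∷ 1 ∷ []) f (x ∷ inp) st → t ≤ z
  lower-bound z∈ with ∈-run⁻ _ f (x ∷ inp) st z∈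
  ... | inj₁ z∈st = All.lookup (Linked⇒All-head ≤-trans lk) z∈st
  ... | inj₂ (here refl) = <⇒≤ t<x
  ... | inj₂ (there z∈inp) =
    ≮⇒≥ (λ z<t → ¬up (inj₂ (t , _ , here refl , refl ∷ from∈ z∈inp , is231 z<t t<x)))

run21-descent : ∀ f inp st → Fuel f inp st → Linked _≤_ st → Upcoming Is231 st inp →
              Occurs Is21 (run (2 ∷ 1 ∷ []) f inp st)
run21-descent (suc f) [] st _ _ (inj₁ (_ , [] , ()))
run21-descent (suc f) [] st _ _ (inj₂ (_ , _ , _ , [] , ()))
run21-descent (suc f) (x ∷ inp) [] enough _ up =
  run21-descent f inp (x ∷ []) (fuel-push enough) [-] (upcoming-push⁺ (λ ()) up)
run21-descent (suc f) (x ∷ inp) (t ∷ st) enough lk up with step (2 ∷ 1 ∷ []) f x inp t st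
... | push ¬pops e rewrite e =
  run21-descent f inp (x ∷ t ∷ st) (fuel-push enough) (x≤t ∷ lk) (upcoming-push⁺ unblocked up)
  where
  x≤t : x ≤ t
  x≤t = ≮⇒≥ (¬pops ∘ Equivalence.from (increasing-contains-21⇔ lk))
  unblocked : ∀ {b rest} → b ∈ t ∷ st → ¬ Is231 (b ∷ x ∷ rest)
  unblocked b∈ (is231 _ b<x) = <⇒≱ b<x (All.lookup (Linked⇒All ≤-trans x≤t lk) b∈)
... | pop pops e rewrite e with upcoming-pop⁻ up
...   | inj₁ up′ = Occurs-∷ʳ (run21-descent f (x ∷ inp) st (fuel-pop enough) (Linked.tail lk) up′)
...   | inj₂ (_ , s , is231 a<t _) =
  t ∷ _ , refl ∷ from∈ (∈-run⁺ _ f (x ∷ inp) st (fuel-pop enough) (to∈ (∷ˡ⁻ s))) , is21 a<t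

s21-sorted⇔avoids231 : ∀ w → WeaklyIncreasing (sτ (2 ∷ 1 ∷ []) w) ⇔ (¬ Occurs Is231 w)
s21-sorted⇔avoids231 w = mk⇔
  (λ sorted o → sorted-avoids21 sorted (run21-descent (suc (2 * length w)) w [] (fuel-init w) [] (inj₁ o)))
  (λ ¬o → run21-sorted (suc (2 * length w)) w [] [] (¬o ∘ upcoming-[]⁻))

theorem3 : (π : List ℕ) → IsCayley π →
    (Sortable (1 ∷ 2 ∷ []) π ⇔ Avoids π (2 ∷ 1 ∷ 3 ∷ []))
theorem3 π _ = begin
  Sortable (1 ∷ 2 ∷ []) π             ≈⟨ s21-sorted⇔avoids231 (sτ (1 ∷ 2 ∷ []) π) ⟩
  ¬ Occurs Is231 (sτ (1 ∷ 2 ∷ []) π)  ≈⟨ s12-avoids231⇔avoids213 π ⟩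
  ¬ Occurs Is213 π                    ≈⟨ ¬-cong-⇔ (contains-213⇔ π) ⟨
  Avoids π (2 ∷ 1 ∷ 3 ∷ [])           ∎
  where open SetoidReasoning (⇔-setoid 0ℓ)
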